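{- Let $E^+, E^-$ be an instance of the ILP consistency problem for the setting $\mathcal{G}$. If this instance has a solution, then it also has a solution $H$ with $|H| \leq 1 + \sum_{E \in E^- } |E|$, where $|C|$ denotes the number of literals of a clause $C$.
   Context: Clauses are finite disjunctions of first-order literals, treated as sets of literals (no duplicate literals). A clause $\phi$ $\theta$-subsumes a clause $\psi$, written $\phi \vdash \psi$, if there is a variable substitution $\theta$ with $\phi\theta \subseteq \psi$. For a set $E$ of clauses, $H \vdash E$ means $H \vdash e$ for every $e \in E$, and $H \not\vdash E$ means $H \not\vdash e$ for every $e \in E$. A clause $C$ is guarded if there is a literal $G \in C$ with $\bigcup_{R \in C} \mathrm{vars}(R) \subseteq \mathrm{vars}(G)$. The ILP setting $\mathcal{G}$: given finite sets $E^+$, $E^-$ of ground clauses, a solution is a function-free guarded clause $H$ with $H \vdash E^+$, $H \not\vdash E^-$, and $\{H\}$ consistent; the ILP consistency problem asks whether a solution exists. -}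

module Defs where

open import Data.Nat using (ℕ; _≤_; _+_)
open import Data.Bool using (Bool; true; false; T)
open import Data.List using (List; []; _∷_; map; length)
open import Data.List.Relation.Unary.All using (All)
open import Data.List.Relation.Unary.Any using (Any)
open import Data.List.Relation.Unary.Unique.Propositional using (Unique)
open import Data.List.Membership.Propositional using (_∈_)
open import Data.Product using (Σ; ∃; _×_; _,_; proj₁)
open import Relation.Binary.PropositionalEquality using (_≡_)
open import Relation.Nullary using (¬_)

-- Symbols: variables, function symbols (constants = 0-ary function
-- symbols) and predicate symbols are all drawn from ℕ.
Var : Set
Var = ℕ

FunSym : Set
FunSym = ℕ

PredSym : Set
PredSym = ℕ

data Term : Set where
  var : Var → Term
  fn  : FunSym → List Term → Term

-- A literal: polarity (true = positive), predicate symbol, arguments.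
record Literal : Set where
  constructor lit
  field
    pos  : Bool
    pred : PredSym
    args : List Term
open Literal public

-- A clause: a finite set of literals, represented by a duplicate-free list.
Clause : Set
Clause = Σ (List Literal) Unique

lits : Clause → List Literal
lits = proj₁

size : Clause → ℕ
size C = length (lits C)

data _occursIn_ (x : Var) : Term → Set where
  here : x occursIn var x
  arg  : ∀ {f ts} → Any (x occursIn_) ts → x occursIn fn f ts

_∈vars_ : Var → Literal → Set
x ∈vars L = Any (x occursIn_) (args L)

GroundClause : Clause → Set
GroundClause C = ∀ L → L ∈ lits C → ∀ x → ¬ (x ∈vars L)

data FunFreeTerm : Term → Set where
  v : ∀ x → FunFreeTerm (var x)
  c : ∀ a → FunFreeTerm (fn a [])

FunctionFree : Clause → Set
FunctionFree C = All (λ L → All FunFreeTerm (args L)) (lits C)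

Guarded : Clause → Set
Guarded C = ∃ λ G → G ∈ lits C × (∀ R → R ∈ lits C → ∀ x → x ∈vars R → x ∈vars G)

Subst : Set
Subst = Var → Term

mutual
  substT : Subst → Term → Term
  substT θ (var x)   = θ x
  substT θ (fn f ts) = fn f (substTs θ ts)

  substTs : Subst → List Term → List Term
  substTs θ []       = []
  substTs θ (t ∷ ts) = substT θ t ∷ substTs θ ts

substL : Subst → Literal → Literal
substL θ (lit p q ts) = lit p q (substTs θ ts)

_⊢_ : Clause → Clause → Set
φ ⊢ ψ = ∃ λ (θ : Subst) → ∀ L → L ∈ lits φ → substL θ L ∈ lits ψ

_⊢all_ : Clause → List Clause → Set
H ⊢all E = All (H ⊢_) E

_⊬all_ : Clause → List Clause → Set
H ⊬all E = All (λ e → ¬ (H ⊢ e)) E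

record Structure : Set₁ where
  field
    Dom      : Set
    inhabit  : Dom
    funI     : FunSym → List Dom → Dom
    predI    : PredSym → List Dom → Bool

module _ (M : Structure) where
  open Structure M
  mutual
    evalT : (Var → Dom) → Term → Dom
    evalT σ (var x)   = σ x
    evalT σ (fn f ts) = funI f (evalTs σ ts)

    evalTs : (Var → Dom) → List Term → List Dom
    evalTs σ []       = []
    evalTs σ (t ∷ ts) = evalT σ t ∷ evalTs σ ts

  holdsL : (Var → Dom) → Literal → Set
  holdsL σ (lit true  q ts) = T (predI q (evalTs σ ts))
  holdsL σ (lit false q ts) = ¬ T (predI q (evalTs σ ts))

  Models : Clause → Set
  Models C = ∀ (σ : Var → Dom) → Any (holdsL σ) (lits C)

Consistent : Clause → Set₁
Consistent H = ∃ λ (M : Structure) → Models M H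

record Solution (Epos Eneg : List Clause) (H : Clause) : Set₁ where
  field
    funFree    : FunctionFree H
    guarded    : Guarded H
    covers     : H ⊢all Epos
    rejects    : H ⊬all Eneg
    consistent : Consistent H

GroundInstance : List Clause → List Clause → Set
GroundInstance Epos Eneg = All GroundClause Epos × All GroundClause Eneg

{-# OPTIONS --safe #-}
module Submission where

-- Let G be a guard of a solution H. A candidate substitution θ with
-- Gθ = L for a literal L of a negative example e is determined on vars(G),
-- hence on all of H; if it does not map H into e, some literal of H escapes
-- e under it. Keeping G and one such escaping literal for every pair (e, L)
-- gives a sub-clause H' with |H'| ≤ 1 + Σ_{e ∈ E⁻} |e|. Every θ mapping H' into e sends
-- G to some L ∈ e and then agrees with the candidate for L, so it cannot map
-- the escaping literal chosen for L into e: hence H' ⊬ e. Being a sub-clause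
-- containing G, H' inherits all other properties of a solution.

open import Defs
open import Data.Nat using (ℕ; _≤_; _+_; z≤n; s≤s)
import Data.Nat as ℕ
open import Data.Nat.Properties using (+-mono-≤; ≤-trans)
open import Data.Nat.ListAction using (sum)
import Data.Bool as Bool
open import Data.Bool using (Bool; true; false)
open import Data.Unit using (⊤; tt)
open import Data.Empty using (⊥-elim)
open import Data.Maybe using (Maybe; just; nothing; fromMaybe; _<∣>_)
open import Data.List using (List; []; _∷_; map; length; mapMaybe; concatMap; deduplicate; find)
open import Data.List.Properties using (length-++; length-mapMaybe; length-deduplicate)
open import Data.List.Relation.Unary.All as All using (All; []; _∷_)
open import Data.List.Relation.Unary.Any as Any using (Any; here; there)
open import Data.List.Membership.Propositional using (_∈_; _∉_)
open import Data.List.Membership.Propositional.Properties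
  using (∈-concatMap⁺; ∈-concatMap⁻; ∈-deduplicate⁺; ∈-deduplicate⁻)
open import Data.List.Relation.Binary.Subset.Propositional using (_⊆_)
open import Data.List.Relation.Unary.All.Properties using (anti-mono)
open import Data.Product using (∃; _×_; _,_; proj₁; proj₂)
import Data.Product as Product
open import Function using (id; _∘_)
open import Relation.Binary.Definitions using (DecidableEquality)
open import Relation.Binary.PropositionalEquality using (_≡_; refl; sym; trans; cong; cong₂; subst)
open import Relation.Nullary using (¬_; yes; no)
open import Relation.Nullary.Decidable using (map′; _×-dec_; ¬?; decidable-stable)
open import Relation.Unary using (Pred; Decidable; ∁)

find-just : ∀ {a p} {A : Set a} {P : Pred A p} (P? : Decidable P) xs {x} →
            find P? xs ≡ just x → x ∈ xs × P x
find-just P? (y ∷ xs) eq with P? y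
find-just P? (y ∷ xs) refl | yes py = here refl , py
... | no _ = Product.map there id (find-just P? xs eq)

find-nothing : ∀ {a p} {A : Set a} {P : Pred A p} (P? : Decidable P) xs →
               find P? xs ≡ nothing → All (∁ P) xs
find-nothing P? []       eq = []
find-nothing P? (y ∷ xs) eq with P? y
... | no ¬py = ¬py ∷ find-nothing P? xs eq

module _ {a b} {A : Set a} {B : Set b} (f : A → Maybe B) where

  ∈-mapMaybe⁺ : ∀ {xs x y} → x ∈ xs → f x ≡ just y → y ∈ mapMaybe f xs
  ∈-mapMaybe⁺ {x ∷ _} (here refl) fx≡y rewrite fx≡y = here refl
  ∈-mapMaybe⁺ {z ∷ _} (there x∈xs) fx≡y with f z
  ... | nothing = ∈-mapMaybe⁺ x∈xs fx≡y
  ... | just _  = there (∈-mapMaybe⁺ x∈xs fx≡y)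

  ∈-mapMaybe⁻ : ∀ xs {y} → y ∈ mapMaybe f xs → ∃ λ x → x ∈ xs × f x ≡ just y
  ∈-mapMaybe⁻ (x ∷ xs) y∈ with f x in fx≡
  ∈-mapMaybe⁻ (x ∷ xs) (here refl) | just _  = x , here refl , fx≡
  ∈-mapMaybe⁻ (x ∷ xs) (there y∈)  | just _  = Product.map₂ (Product.map₁ there) (∈-mapMaybe⁻ xs y∈)
  ∈-mapMaybe⁻ (x ∷ xs) y∈          | nothing = Product.map₂ (Product.map₁ there) (∈-mapMaybe⁻ xs y∈)

length-concatMap-≤ : ∀ {a b} {A : Set a} {B : Set b} (f : A → List B) (g : A → ℕ) →
                     (∀ x → length (f x) ≤ g x) →
                     ∀ xs → length (concatMap f xs) ≤ sum (map g xs)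
length-concatMap-≤ f g f≤g []       = z≤n
length-concatMap-≤ f g f≤g (x ∷ xs) rewrite length-++ (f x) {concatMap f xs} =
  +-mono-≤ (f≤g x) (length-concatMap-≤ f g f≤g xs)

mutual
  _≟ᵗ_ : DecidableEquality Term
  var x   ≟ᵗ var y   = map′ (cong var) (λ { refl → refl }) (x ℕ.≟ y)
  var _   ≟ᵗ fn _ _  = no λ ()
  fn _ _  ≟ᵗ var _   = no λ ()
  fn f ts ≟ᵗ fn g us = map′ (λ { (refl , refl) → refl }) (λ { refl → refl , refl })
                            (f ℕ.≟ g ×-dec ts ≟ᵗˢ us)

  _≟ᵗˢ_ : DecidableEquality (List Term)
  []       ≟ᵗˢ []       = yes refl
  []       ≟ᵗˢ (_ ∷ _)  = no λ ()
  (_ ∷ _)  ≟ᵗˢ []       = no λ ()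
  (t ∷ ts) ≟ᵗˢ (u ∷ us) = map′ (λ { (refl , refl) → refl }) (λ { refl → refl , refl })
                               (t ≟ᵗ u ×-dec ts ≟ᵗˢ us)

_≟ˡ_ : DecidableEquality Literal
lit p q ts ≟ˡ lit p′ q′ ts′ =
  map′ (λ { (refl , refl , refl) → refl }) (λ { refl → refl , refl , refl })
       (p Bool.≟ p′ ×-dec q ℕ.≟ q′ ×-dec ts ≟ᵗˢ ts′)

open import Data.List.Membership.DecPropositional _≟ˡ_ using (_∈?_)
open import Data.List.Relation.Unary.Unique.DecPropositional.Properties _≟ˡ_ using (deduplicate-!)

-- The subterm of t at the first occurrence of x in the pattern p; later
-- occurrences are not checked for consistency.
mutual
  matchVar : Var → Term → Term → Maybe Term
  matchVar x (var y)   t with x ℕ.≟ y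
  ... | yes _ = just t
  ... | no _  = nothing
  matchVar x (fn _ ps) (var _)   = nothing
  matchVar x (fn _ ps) (fn _ ts) = matchVars x ps ts

  matchVars : Var → List Term → List Term → Maybe Term
  matchVars x []       _        = nothing
  matchVars x (p ∷ ps) []       = nothing
  matchVars x (p ∷ ps) (t ∷ ts) = matchVar x p t <∣> matchVars x ps ts

mutual
  matchVar-sound : ∀ θ x p {u} → matchVar x p (substT θ p) ≡ just u → u ≡ θ x
  matchVar-sound θ x (var y) eq with x ℕ.≟ y
  matchVar-sound θ x (var .x) refl | yes refl = refl
  matchVar-sound θ x (fn f ps) eq = matchVars-sound θ x ps eq

  matchVars-sound : ∀ θ x ps {u} → matchVars x ps (substTs θ ps) ≡ just u → u ≡ θ x
  matchVars-sound θ x (p ∷ ps) eq with matchVar x p (substT θ p) in eq′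
  matchVars-sound θ x (p ∷ ps) refl | just _ = matchVar-sound θ x p eq′
  ... | nothing = matchVars-sound θ x ps eq

mutual
  matchVar-complete : ∀ θ x p → x occursIn p → matchVar x p (substT θ p) ≡ just (θ x)
  matchVar-complete θ x (var .x) here with x ℕ.≟ x
  ... | yes _  = refl
  ... | no x≢x = ⊥-elim (x≢x refl)
  matchVar-complete θ x (fn f ps) (arg x∈ps) = matchVars-complete θ x ps x∈ps

  matchVars-complete : ∀ θ x ps → Any (x occursIn_) ps →
                       matchVars x ps (substTs θ ps) ≡ just (θ x)
  matchVars-complete θ x (p ∷ ps) x∈ with matchVar x p (substT θ p) in eq
  ... | just _ = cong just (matchVar-sound θ x p eq)
  matchVars-complete θ x (p ∷ ps) (here x∈p) | nothing
    with () ← trans (sym eq) (matchVar-complete θ x p x∈p)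
  matchVars-complete θ x (p ∷ ps) (there x∈ps) | nothing = matchVars-complete θ x ps x∈ps

matcher : Literal → Literal → Subst
matcher G L x = fromMaybe (var x) (matchVars x (args G) (args L))

matcher-correct : ∀ θ G {x} → x ∈vars G → matcher G (substL θ G) x ≡ θ x
matcher-correct θ (lit p q ts) {x} x∈G rewrite matchVars-complete θ x ts x∈G = refl

mutual
  substT-cong : ∀ θ θ′ t → (∀ x → x occursIn t → θ x ≡ θ′ x) → substT θ t ≡ substT θ′ t
  substT-cong θ θ′ (var x)   θ≗θ′ = θ≗θ′ x here
  substT-cong θ θ′ (fn f ts) θ≗θ′ = cong (fn f) (substTs-cong θ θ′ ts (λ x → θ≗θ′ x ∘ arg))

  substTs-cong : ∀ θ θ′ ts → (∀ x → Any (x occursIn_) ts → θ x ≡ θ′ x) →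
                 substTs θ ts ≡ substTs θ′ ts
  substTs-cong θ θ′ []       θ≗θ′ = refl
  substTs-cong θ θ′ (t ∷ ts) θ≗θ′ =
    cong₂ _∷_ (substT-cong θ θ′ t (λ x → θ≗θ′ x ∘ here))
              (substTs-cong θ θ′ ts (λ x → θ≗θ′ x ∘ there))

substL-cong : ∀ θ θ′ R → (∀ x → x ∈vars R → θ x ≡ θ′ x) → substL θ R ≡ substL θ′ R
substL-cong θ θ′ (lit p q ts) = cong (lit p q) ∘ substTs-cong θ θ′ ts

_Guards_ : Literal → Clause → Set
G Guards C = ∀ R → R ∈ lits C → ∀ x → x ∈vars R → x ∈vars G

matcher-agrees : ∀ {G C} → G Guards C → ∀ θ {R} → R ∈ lits C →
                 substL (matcher G (substL θ G)) R ≡ substL θ R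
matcher-agrees {G} G-guards θ {R} R∈C =
  substL-cong _ θ R (λ x → matcher-correct θ G ∘ G-guards R R∈C x)

escapee : Subst → List Literal → List Literal → Maybe Literal
escapee θ e = find (λ R → ¬? (substL θ R ∈? e))

escapee-just : ∀ θ e Rs {R} → escapee θ e Rs ≡ just R → R ∈ Rs × substL θ R ∉ e
escapee-just θ e Rs = find-just (λ R → ¬? (substL θ R ∈? e)) Rs

escapee-nothing : ∀ θ e Rs → escapee θ e Rs ≡ nothing → ∀ {R} → R ∈ Rs → substL θ R ∈ e
escapee-nothing θ e Rs eq {R} R∈Rs =
  decidable-stable (substL θ R ∈? e) (All.lookup (find-nothing _ Rs eq) R∈Rs)

module Reduct (G : Literal) (H : Clause) (Es : List Clause) where

  escapeeAt : Clause → Literal → Maybe Literal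
  escapeeAt e L = escapee (matcher G L) (lits e) (lits H)

  witnesses : Clause → List Literal
  witnesses e = mapMaybe (escapeeAt e) (lits e)

  reduct : Clause
  reduct = deduplicate _≟ˡ_ (G ∷ concatMap witnesses Es) , deduplicate-! (G ∷ concatMap witnesses Es)

  size-reduct : size reduct ≤ 1 + sum (map size Es)
  size-reduct = ≤-trans (length-deduplicate _≟ˡ_ (G ∷ concatMap witnesses Es))
    (s≤s (length-concatMap-≤ witnesses size (length-mapMaybe _ ∘ lits) Es))

  G∈reduct : G ∈ lits reduct
  G∈reduct = ∈-deduplicate⁺ _≟ˡ_ {xs = G ∷ concatMap witnesses Es} (here refl)

  witness∈reduct : ∀ {e L R} → e ∈ Es → L ∈ lits e → escapeeAt e L ≡ just R →
                   R ∈ lits reduct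
  witness∈reduct {e} e∈Es L∈e eq = ∈-deduplicate⁺ _≟ˡ_ {xs = G ∷ concatMap witnesses Es} (there
    (∈-concatMap⁺ witnesses (Any.map (λ { refl → ∈-mapMaybe⁺ (escapeeAt e) L∈e eq }) e∈Es)))

  reduct-⊆ : G ∈ lits H → lits reduct ⊆ lits H
  reduct-⊆ G∈H R∈ with ∈-deduplicate⁻ _≟ˡ_ (G ∷ concatMap witnesses Es) R∈
  ... | here refl  = G∈H
  ... | there R∈ws with Any.satisfied (∈-concatMap⁻ witnesses {xs = Es} R∈ws)
  ...   | e , R∈we with ∈-mapMaybe⁻ (escapeeAt e) (lits e) R∈we
  ...     | L , _ , eq = proj₁ (escapee-just (matcher G L) (lits e) (lits H) eq)

  reduct-rejects : G Guards H → ∀ {e} → e ∈ Es → ¬ H ⊢ e → ¬ reduct ⊢ e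
  reduct-rejects G-guards {e} e∈Es H⊬e (θ , θ-maps) with escapeeAt e (substL θ G) in eq
  ... | nothing = H⊬e (matcher G (substL θ G) , λ R → escapee-nothing _ (lits e) (lits H) eq)
  ... | just R with R∈H , R∉e ← escapee-just _ (lits e) (lits H) eq =
    R∉e (subst (_∈ lits e) (sym (matcher-agrees {G} {H} G-guards θ R∈H))
              (θ-maps R (witness∈reduct e∈Es (θ-maps G G∈reduct) eq)))

pointStructure : Bool → Structure
pointStructure b = record { Dom = ⊤ ; inhabit = tt ; funI = λ _ _ → tt ; predI = λ _ _ → b }

pointStructure-holds : ∀ L σ → holdsL (pointStructure (pos L)) σ L
pointStructure-holds (lit true  _ _) σ = tt
pointStructure-holds (lit false _ _) σ = λ ()

∈⇒Consistent : ∀ {L C} → L ∈ lits C → Consistent C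
∈⇒Consistent {L} L∈C =
  pointStructure (pos L) , λ σ → Any.map (λ { refl → pointStructure-holds L σ }) L∈C

⊆-Solution : ∀ {Epos Eneg H H′} (sol : Solution Epos Eneg H) →
             proj₁ (Solution.guarded sol) ∈ lits H′ → lits H′ ⊆ lits H →
             H′ ⊬all Eneg → Solution Epos Eneg H′
⊆-Solution {H = H} {H′} sol G∈H′ H′⊆H H′⊬Eneg = record
  { funFree    = anti-mono {xs = lits H′} H′⊆H funFree
  ; guarded    = G , G∈H′ , λ R → G-guards R ∘ H′⊆H
  ; covers     = All.map (Product.map₂ (λ θ-maps L → θ-maps L ∘ H′⊆H)) covers
  ; rejects    = H′⊬Eneg
  ; consistent = ∈⇒Consistent {C = H′} G∈H′
  }
  where
  open Solution sol
  G : Literal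
  G = proj₁ guarded
  G-guards : G Guards H
  G-guards = proj₂ (proj₂ guarded)

lemma3 : (Epos Eneg : List Clause) → GroundInstance Epos Eneg →
           ∃ (Solution Epos Eneg) →
           ∃ λ H → Solution Epos Eneg H × size H ≤ 1 + sum (map size Eneg)
-- The argument does not need the examples to be ground.
lemma3 Epos Eneg _ (H , sol) =
  reduct , ⊆-Solution sol G∈reduct (reduct-⊆ G∈H) reduct-⊬Eneg , size-reduct
  where
  open Solution sol using (guarded; rejects)
  G : Literal
  G = proj₁ guarded
  G∈H : G ∈ lits H
  G∈H = proj₁ (proj₂ guarded)
  G-guards : G Guards H
  G-guards = proj₂ (proj₂ guarded)
  open Reduct G H Eneg

  reduct-⊬Eneg : reduct ⊬all Eneg
  reduct-⊬Eneg = All.tabulate λ e∈ → reduct-rejects G-guards e∈ (All.lookup rejects e∈)
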